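{- Let $G=(V,E)$ be a finite graph (multiple edges and loops allowed) with a linear order $<$ on $E$, and let $\bar{x}=(x_1,\ldots,x_{|V|})$ and $y$ be indeterminates. Define $$U'(G,\bar{x},y)=\sum_{A\subseteq E}\ \prod_{i=1}^{|V|}x_i^{k_i((V,A))}\,y^{|A|}.$$ Then $$U'(G,\bar{x},y)=\sum_{F=(V,A_f)\in\mathcal{F}(G)}\ \sum_{A_i\subseteq E_i(F,G,<)}\ \prod_{i=1}^{|V|}x_i^{k_i((V,A_f\setminus A_i))}\,y^{|A_f\setminus A_i|}\,(1+y)^{e(F,G,<)}.$$
   Context: A graph $G=(V,E)$ consists of a finite vertex set $V$ and a finite multiset $E$ of edges, each a one- or two-element subset of $V$. $k(H)$ denotes the number of connected components of $H$, and $k_i(H)$ the number of connected components of $H$ containing exactly $i$ vertices. $H_{ -e}$, $H_{+f}$ denote deletion of edge $e$ and addition of edge $f$. A spanning forest of $G$ is a forest $F=(V,A)$ with $A\subseteq E$ and $k(F)=k(G)$; $\mathcal{F}(G)$ is the set of spanning forests. For $F=(V,A)\in\mathcal{F}(G)$: $e\in A$ is internally active if there is no $f\in E\setminus A$ with $e<f$ and $F_{ -e+f}\in\mathcal{F}(G)$, and $E_i(F,G,<)$ is the set of such edges; $f\in E\setminus A$ is externally active if there is no $e\in A$ with $f<e$ and $F_{ -e+f}\in\mathcal{F}(G)$, $E_e(F,G,<)$ is the set of such edges and $e(F,G,<)=|E_e(F,G,<)|$. -}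

module Defs where

open import Level using (Level)
open import Data.Nat using (ℕ; zero; suc; _≡ᵇ_)
open import Data.Bool using (Bool; true; false; _∧_; _∨_; not; if_then_else_)
open import Data.Fin using (Fin; zero; suc; toℕ; _≟_; _<?_)
open import Data.Product using (_×_; proj₁; proj₂)
open import Data.Vec using (Vec; []; _∷_; lookup; _[_]≔_; replicate)
open import Data.Fin.Subset using (Subset; _─_; ∣_∣)
open import Relation.Nullary.Decidable using (⌊_⌋)
open import Algebra.Bundles using (CommutativeSemiring)

anyFin : (k : ℕ) → (Fin k → Bool) → Bool
anyFin zero    p = false
anyFin (suc k) p = p zero ∨ anyFin k (λ i → p (suc i))

allFin : (k : ℕ) → (Fin k → Bool) → Bool
allFin zero    p = true
allFin (suc k) p = p zero ∧ allFin k (λ i → p (suc i))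

countFin : (k : ℕ) → (Fin k → Bool) → ℕ
countFin zero    p = 0
countFin (suc k) p = (if p zero then 1 else 0) Data.Nat.+ countFin k (λ i → p (suc i))

-- A graph G = (V, E): V = Fin n, E = Fin m (edges indexed, so the
-- multiset of edges is represented; parallel edges and loops allowed);
-- 'ends e' gives the (one or two) endpoints of edge e (a loop has
-- equal endpoints).  The linear order < on E is the order of Fin m.

module _ {n m : ℕ} (ends : Fin m → Fin n × Fin n) where

  src tgt : Fin m → Fin n
  src e = proj₁ (ends e)
  tgt e = proj₂ (ends e)

  mem : Subset m → Fin m → Bool
  mem A e = lookup A e

  reach : Subset m → ℕ → Fin n → Fin n → Bool
  reach A zero    u v = ⌊ u ≟ v ⌋
  reach A (suc k) u v = reach A k u v ∨ anyFin m (λ e → mem A e ∧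
      ((reach A k u (src e) ∧ ⌊ tgt e ≟ v ⌋) ∨ (reach A k u (tgt e) ∧ ⌊ src e ≟ v ⌋)))

  -- u and v lie in the same connected component of (V, A)
  -- (a walk, if any, can be shortened to a path of length < n)
  connected : Subset m → Fin n → Fin n → Bool
  connected A u v = reach A n u v

  compSize : Subset m → Fin n → ℕ
  compSize A v = countFin n (λ w → connected A v w)

  isRep : Subset m → Fin n → Bool
  isRep A v = not (anyFin n (λ w → ⌊ w <? v ⌋ ∧ connected A v w))

  k : Subset m → ℕ
  k A = countFin n (isRep A)

  kSize : Subset m → ℕ → ℕ
  kSize A i = countFin n (λ v → isRep A v ∧ (compSize A v ≡ᵇ i))

  allE : Subset m
  allE = replicate m true

  -- (V, A) is a forest: no edge of A lies on a cycle, i.e. for every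
  -- edge e ∈ A, its endpoints are not connected in (V, A ∖ {e})
  -- (a loop or a parallel edge thus violates this)
  isForest : Subset m → Bool
  isForest A = allFin m (λ e → not (mem A e) ∨ not (connected (A [ e ]≔ false) (src e) (tgt e)))

  isSpanningForest : Subset m → Bool
  isSpanningForest A = isForest A ∧ (k A ≡ᵇ k allE)

  swap : Subset m → Fin m → Fin m → Subset m
  swap A e f = (A [ e ]≔ false) [ f ]≔ true

  internallyActive : Subset m → Fin m → Bool
  internallyActive A e = mem A e ∧ not (anyFin m (λ f →
      not (mem A f) ∧ ⌊ e <? f ⌋ ∧ isSpanningForest (swap A e f)))

  externallyActive : Subset m → Fin m → Bool
  externallyActive A f = not (mem A f) ∧ not (anyFin m (λ e →
      mem A e ∧ ⌊ f <? e ⌋ ∧ isSpanningForest (swap A e f)))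

  Eint : Subset m → Subset m
  Eint A = Data.Vec.tabulate (internallyActive A)

  eAct : Subset m → ℕ
  eAct A = countFin m (externallyActive A)

subsetᵇ : {m : ℕ} → Subset m → Subset m → Bool
subsetᵇ {m} S T = allFin m (λ e → not (lookup S e) ∨ lookup T e)

-- Evaluation in an arbitrary commutative semiring R (the identity of
-- polynomials with ℕ coefficients in x₁..x_n, y is equivalent to its
-- validity for all values in all commutative semirings).

module Poly {c ℓ : Level} (R : CommutativeSemiring c ℓ) where
  open CommutativeSemiring R
  open import Algebra.Definitions.RawSemiring rawSemiring using (_^_; product)

  sumSubsets : (m : ℕ) → (Subset m → Carrier) → Carrier
  sumSubsets zero    f = f []
  sumSubsets (suc m) f = sumSubsets m (λ s → f (false ∷ s)) + sumSubsets m (λ s → f (true ∷ s))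

  module _ {n m : ℕ} (ends : Fin m → Fin n × Fin n) (x : Fin n → Carrier) (y : Carrier) where

    -- ∏_{i=1}^{|V|} x_i^{k_i((V,A))}   (x j stands for x_{j+1})
    xmono : Subset m → Carrier
    xmono A = product (λ j → x j ^ kSize ends A (suc (toℕ j)))

    U′ : Carrier
    U′ = sumSubsets m (λ A → xmono A * y ^ ∣ A ∣)

    forestExpansion : Carrier
    forestExpansion = sumSubsets m (λ Af →
      if isSpanningForest ends Af
      then sumSubsets m (λ Ai →
             if subsetᵇ Ai (Eint ends Af)
             then xmono (Af ─ Ai) * y ^ ∣ Af ─ Ai ∣ * (1# + y) ^ eAct ends Af
             else 0#)
      else 0#)

module Submission where

-- Proof by deletion–contraction on the least edge 0 = {a, b}.  To make
-- contraction available, graphs carry a background relation R₀ of vertex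
-- pairs that are joined from the start: (V, A) has connectivity CG R₀ A, and
-- the graph of Defs is the case R₀ = ∅.  Contracting edge 0 moves it into
-- R₀.  Splitting the subsets A at edge 0 gives U(G) = U(G∖0) + y U(G/0);
-- the forest expansion satisfies the same recursion, by three cases:
--   loop   (a ~ b in R₀): 0 lies in no spanning forest and is externally
--          active in all the others, a factor (1 + y), and G/0 = G∖0;
--   bridge (a ≁ b in G∖0): 0 lies in every spanning forest, is internally
--          active there, and G∖0, G/0 have the same spanning forests;
--   otherwise 0 is never active, and spanning forests without (with) 0
--          are those of G∖0 (G/0), by exchange arguments.

open import Defs
open import Level using (Level)
open import Function using (_∘_; Equivalence)
open import Data.Nat as ℕ using (ℕ; zero; suc; _≤_; _<_; z≤n; s≤s; _∸_; _≡ᵇ_)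
import Data.Nat.Properties as ℕP
open import Data.Bool using (Bool; true; false; _∧_; _∨_; not; T; if_then_else_)
open import Data.Bool.Properties using (T?; T-∧; T-∨; T-≡; T-not-≡; ∨-assoc; ∧-zeroʳ)
open import Data.Fin using (Fin; zero; suc; toℕ; _≟_; _<?_)
import Data.Fin.Properties as FinP
open import Data.Fin.Subset using (Subset; _─_; ∣_∣)
open import Data.Vec using ([]; _∷_; lookup; _[_]≔_; replicate; tabulate)
open import Data.Vec.Properties using (lookup∘update; lookup∘update′; lookup-replicate; tabulate-cong)
open import Data.Product using (Σ-syntax; _×_; _,_; proj₁; proj₂)
open import Data.Sum using (_⊎_; inj₁; inj₂)
open import Data.Empty using (⊥-elim)
open import Data.Unit using (tt)
open import Relation.Binary.PropositionalEquality using (_≡_; refl; sym; trans; cong; cong₂; subst)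
open import Relation.Binary.Definitions using (tri<; tri≈; tri>)
open import Relation.Binary.Structures using (IsEquivalence)
open import Relation.Binary.Construct.Closure.ReflexiveTransitive using (ε; _◅_; _◅◅_)
open import Relation.Binary.Construct.Closure.Symmetric using (SymClosure; fwd; bwd)
open import Relation.Binary.Construct.Closure.Equivalence as EqClosure using (EqClosure)
open import Relation.Nullary using (¬_; Dec; yes; no)
open import Relation.Nullary.Decidable using (⌊_⌋; toWitness; fromWitness)
open import Algebra.Bundles using (CommutativeSemiring)

∧-intro : ∀ {a b} → T a → T b → T (a ∧ b)
∧-intro p q = Equivalence.from T-∧ (p , q)

∧-fst : ∀ {a b} → T (a ∧ b) → T a
∧-fst = proj₁ ∘ Equivalence.to T-∧

∧-snd : ∀ {a b} → T (a ∧ b) → T b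
∧-snd = proj₂ ∘ Equivalence.to T-∧

∨-inl : ∀ {a b} → T a → T (a ∨ b)
∨-inl p = Equivalence.from T-∨ (inj₁ p)

∨-inr : ∀ {a b} → T b → T (a ∨ b)
∨-inr p = Equivalence.from T-∨ (inj₂ p)

∨-elim : ∀ {a b} → T (a ∨ b) → T a ⊎ T b
∨-elim = Equivalence.to T-∨

not-intro : ∀ {a} → ¬ T a → T (not a)
not-intro {true}  f = f tt
not-intro {false} _ = tt

not-elim : ∀ {a} → T (not a) → ¬ T a
not-elim {true} ()

bool-ext : ∀ {a b} → (T a → T b) → (T b → T a) → a ≡ b
bool-ext {true}  {true}  _ _ = refl
bool-ext {true}  {false} f _ = ⊥-elim (f tt)
bool-ext {false} {true}  _ g = ⊥-elim (g tt)
bool-ext {false} {false} _ _ = refl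

true-≡ : ∀ {a} → T a → a ≡ true
true-≡ = Equivalence.to T-≡

false-≡ : ∀ {a} → ¬ T a → a ≡ false
false-≡ f = Equivalence.to T-not-≡ (not-intro f)

anyFin-cong : ∀ k {p q : Fin k → Bool} → (∀ i → p i ≡ q i) → anyFin k p ≡ anyFin k q
anyFin-cong zero    h = refl
anyFin-cong (suc k) h = cong₂ _∨_ (h zero) (anyFin-cong k (h ∘ suc))

allFin-cong : ∀ k {p q : Fin k → Bool} → (∀ i → p i ≡ q i) → allFin k p ≡ allFin k q
allFin-cong zero    h = refl
allFin-cong (suc k) h = cong₂ _∧_ (h zero) (allFin-cong k (h ∘ suc))

countFin-cong : ∀ k {p q : Fin k → Bool} → (∀ i → p i ≡ q i) → countFin k p ≡ countFin k q
countFin-cong zero    h = refl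
countFin-cong (suc k) h = cong₂ (λ b c → (if b then 1 else 0) ℕ.+ c) (h zero) (countFin-cong k (h ∘ suc))

anyFin-none : ∀ k {p} → (∀ i → ¬ T (p i)) → anyFin k p ≡ false
anyFin-none zero    h = refl
anyFin-none (suc k) h = cong₂ _∨_ (false-≡ (h zero)) (anyFin-none k (h ∘ suc))

anyFin-elim : ∀ k {p} → T (anyFin k p) → Σ[ i ∈ Fin k ] T (p i)
anyFin-elim (suc k) {p} t with ∨-elim {p zero} t
... | inj₁ q = zero , q
... | inj₂ q with anyFin-elim k q
...   | i , r = suc i , r

anyFin-intro : ∀ k {p} i → T (p i) → T (anyFin k p)
anyFin-intro (suc k) zero    t = ∨-inl t
anyFin-intro (suc k) {p} (suc i) t = ∨-inr {p zero} (anyFin-intro k i t)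

anyFin-some : ∀ k {p} i → T (p i) → anyFin k p ≡ true
anyFin-some k i t = true-≡ (anyFin-intro k i t)

allFin-elim : ∀ k {p} → T (allFin k p) → ∀ i → T (p i)
allFin-elim (suc k) {p} t zero    = ∧-fst {p zero} t
allFin-elim (suc k) {p} t (suc i) = allFin-elim k (∧-snd {p zero} t) i

allFin-intro : ∀ k {p} → (∀ i → T (p i)) → T (allFin k p)
allFin-intro zero    h = tt
allFin-intro (suc k) h = ∧-intro (h zero) (allFin-intro k (h ∘ suc))

_⊆ᵇ_ : ∀ {k} → (Fin k → Bool) → (Fin k → Bool) → Set
p ⊆ᵇ q = ∀ i → T (p i) → T (q i)

countFin-≤ : ∀ k p → countFin k p ≤ k
countFin-≤ zero    p = z≤n
countFin-≤ (suc k) p with p zero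
... | true  = s≤s (countFin-≤ k (p ∘ suc))
... | false = ℕP.m≤n⇒m≤1+n (countFin-≤ k (p ∘ suc))

countFin-mono : ∀ k {p q} → p ⊆ᵇ q → countFin k p ≤ countFin k q
countFin-mono zero    h = z≤n
countFin-mono (suc k) {p} {q} h with p zero in ep | q zero in eq
... | true  | true  = s≤s (countFin-mono k (h ∘ suc))
... | false | true  = ℕP.m≤n⇒m≤1+n (countFin-mono k (h ∘ suc))
... | false | false = countFin-mono k (h ∘ suc)
... | true  | false = ⊥-elim (subst T eq (h zero (subst T (sym ep) tt)))

countFin-strict : ∀ k {p q} → p ⊆ᵇ q → ∀ j → T (q j) → ¬ T (p j) → countFin k p < countFin k q
countFin-strict (suc k) {p} {q} h zero qj ¬pj with p zero in ep | q zero in eq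
... | true  | _     = ⊥-elim (¬pj tt)
... | false | false = ⊥-elim qj
... | false | true  = s≤s (countFin-mono k (h ∘ suc))
countFin-strict (suc k) {p} {q} h (suc j) qj ¬pj with p zero in ep | q zero in eq
... | true  | true  = s≤s (countFin-strict k (h ∘ suc) j qj ¬pj)
... | false | true  = ℕP.m≤n⇒m≤1+n (countFin-strict k (h ∘ suc) j qj ¬pj)
... | false | false = countFin-strict k (h ∘ suc) j qj ¬pj
... | true  | false = ⊥-elim (subst T eq (h zero (subst T (sym ep) tt)))

countFin-≡⇒⊇ : ∀ k {p q} → p ⊆ᵇ q → countFin k p ≡ countFin k q → q ⊆ᵇ p
countFin-≡⇒⊇ k {p} h e i qi with T? (p i)
... | yes pi = pi
... | no ¬pi = ⊥-elim (ℕP.<-irrefl e (countFin-strict k h i qi ¬pi))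

⊆ᵇ-dec : ∀ k (p q : Fin k → Bool) → p ⊆ᵇ q ⊎ Σ[ i ∈ Fin k ] (T (p i) × ¬ T (q i))
⊆ᵇ-dec zero    p q = inj₁ (λ ())
⊆ᵇ-dec (suc k) p q with ⊆ᵇ-dec k (p ∘ suc) (q ∘ suc) | T? (p zero) | T? (q zero)
... | inj₂ (i , pi , ¬qi) | _      | _      = inj₂ (suc i , pi , ¬qi)
... | inj₁ h              | yes p0 | no ¬q0 = inj₂ (zero , p0 , ¬q0)
... | inj₁ h              | yes _  | yes q0 = inj₁ λ { zero _ → q0 ; (suc i) → h i }
... | inj₁ h              | no ¬p0 | _      = inj₁ λ { zero p0 → ⊥-elim (¬p0 p0) ; (suc i) → h i }

BRel : ℕ → Set
BRel n = Fin n → Fin n → Bool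

module _ {n : ℕ} where

  Walk : BRel n → Fin n → Fin n → Set
  Walk R = EqClosure (λ u v → T (R u v))

  step : ∀ {R u v} → T (R u v) → Walk R u v
  step r = fwd r ◅ ε

  rev : ∀ {R u v} → Walk R u v → Walk R v u
  rev = EqClosure.symmetric _

  _≗₂_ : BRel n → BRel n → Set
  R ≗₂ S = ∀ u v → R u v ≡ S u v

  _⊑_ : BRel n → BRel n → Set
  R ⊑ S = ∀ {u v} → T (R u v) → Walk S u v

  walk-map : ∀ {R S u v} → R ⊑ S → Walk R u v → Walk S u v
  walk-map h = EqClosure.fold (EqClosure.isEquivalence _) h

  ⊑-refl : ∀ {R} → R ⊑ R
  ⊑-refl = step

  ⊑-trans : ∀ {R S U} → R ⊑ S → S ⊑ U → R ⊑ U
  ⊑-trans h g r = walk-map g (h r)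

  ⊑-imp : ∀ {R S} → (∀ u v → T (R u v) → T (S u v)) → R ⊑ S
  ⊑-imp h r = step (h _ _ r)

  _∪ᵣ_ : BRel n → BRel n → BRel n
  (R ∪ᵣ S) u v = R u v ∨ S u v

  ⊑-∪ : ∀ {R S U} → R ⊑ U → S ⊑ U → (R ∪ᵣ S) ⊑ U
  ⊑-∪ {R} h g {u} {v} r with ∨-elim {R u v} r
  ... | inj₁ p = h p
  ... | inj₂ q = g q

  ⊑-inl : ∀ {R S} → R ⊑ (R ∪ᵣ S)
  ⊑-inl r = step (∨-inl r)

  ⊑-inr : ∀ {R S} → S ⊑ (R ∪ᵣ S)
  ⊑-inr {R} {u = u} {v} r = step (∨-inr {R u v} r)

  edgeB : Fin n → Fin n → BRel n
  edgeB s t u v = (⌊ s ≟ u ⌋ ∧ ⌊ t ≟ v ⌋) ∨ (⌊ t ≟ u ⌋ ∧ ⌊ s ≟ v ⌋)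

  edgeB-elim : ∀ {s t u v} → T (edgeB s t u v) → (s ≡ u × t ≡ v) ⊎ (t ≡ u × s ≡ v)
  edgeB-elim {s} {t} {u} {v} e with ∨-elim {⌊ s ≟ u ⌋ ∧ ⌊ t ≟ v ⌋} e
  ... | inj₁ p = inj₁ (toWitness {a? = s ≟ u} (∧-fst p) , toWitness {a? = t ≟ v} (∧-snd {⌊ s ≟ u ⌋} p))
  ... | inj₂ q = inj₂ (toWitness {a? = t ≟ u} (∧-fst q) , toWitness {a? = s ≟ v} (∧-snd {⌊ t ≟ u ⌋} q))

  edgeB-intro : ∀ s t → T (edgeB s t s t)
  edgeB-intro s t = ∨-inl (∧-intro (fromWitness {a? = s ≟ s} refl) (fromWitness {a? = t ≟ t} refl))

  edge-⊑ : ∀ {R s t} → Walk R s t → edgeB s t ⊑ R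
  edge-⊑ {s = s} {t} p {u} {v} e with edgeB-elim {s} {t} {u} {v} e
  ... | inj₁ (refl , refl) = p
  ... | inj₂ (refl , refl) = rev p

  transport : ∀ {R} (P : Fin n → Set) → (∀ {u v} → T (R u v) ⊎ T (R v u) → P u → P v) →
    ∀ {u v} → Walk R u v → P u → P v
  transport P h ε              pu = pu
  transport P h (fwd r ◅ rest) pu = transport P h rest (h (inj₁ r) pu)
  transport P h (bwd r ◅ rest) pu = transport P h rest (h (inj₂ r) pu)

  Through : BRel n → Fin n → Fin n → Fin n → Fin n → Set
  Through R s t u v = (Walk R u s × Walk R t v) ⊎ (Walk R u t × Walk R s v)

  exchange : ∀ {R s t u v} → Walk (R ∪ᵣ edgeB s t) u v → Walk R u v ⊎ Through R s t u v
  exchange {R} {s} {t} {u} p = transport (λ v → Walk R u v ⊎ Through R s t u v) extend p (inj₁ ε)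
    where
    extend : ∀ {w v} → T ((R ∪ᵣ edgeB s t) w v) ⊎ T ((R ∪ᵣ edgeB s t) v w) →
      Walk R u w ⊎ Through R s t u w → Walk R u v ⊎ Through R s t u v
    extend-edge : ∀ {w v} → (s ≡ w × t ≡ v) ⊎ (t ≡ w × s ≡ v) →
      Walk R u w ⊎ Through R s t u w → Walk R u v ⊎ Through R s t u v
    extend-edge (inj₁ (refl , refl)) (inj₁ q)                = inj₂ (inj₁ (q , ε))
    extend-edge (inj₁ (refl , refl)) (inj₂ (inj₁ (q , _)))   = inj₂ (inj₁ (q , ε))
    extend-edge (inj₁ (refl , refl)) (inj₂ (inj₂ (q , _)))   = inj₁ q
    extend-edge (inj₂ (refl , refl)) (inj₁ q)                = inj₂ (inj₂ (q , ε))
    extend-edge (inj₂ (refl , refl)) (inj₂ (inj₁ (q , _)))   = inj₁ q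
    extend-edge (inj₂ (refl , refl)) (inj₂ (inj₂ (q , _)))   = inj₂ (inj₂ (q , ε))
    extend-R : ∀ {w v} → SymClosure (λ a b → T (R a b)) w v →
      Walk R u w ⊎ Through R s t u w → Walk R u v ⊎ Through R s t u v
    extend-R r (inj₁ q)               = inj₁ (q ◅◅ (r ◅ ε))
    extend-R r (inj₂ (inj₁ (q , q′))) = inj₂ (inj₁ (q , q′ ◅◅ (r ◅ ε)))
    extend-R r (inj₂ (inj₂ (q , q′))) = inj₂ (inj₂ (q , q′ ◅◅ (r ◅ ε)))
    extend {w} {v} (inj₁ r) with ∨-elim {R w v} r
    ... | inj₁ rr = extend-R (fwd rr)
    ... | inj₂ e  = extend-edge (edgeB-elim e)
    extend {w} {v} (inj₂ r) with ∨-elim {R v w} r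
    ... | inj₁ rr = extend-R (bwd rr)
    ... | inj₂ e with edgeB-elim e
    ...   | inj₁ (a , b) = extend-edge (inj₂ (b , a))
    ...   | inj₂ (a , b) = extend-edge (inj₁ (b , a))

  crossing : ∀ {R u v} (S : Fin n → Bool) → Walk R u v → T (S u) → ¬ T (S v) →
    Σ[ w ∈ Fin n ] Σ[ z ∈ Fin n ] SymClosure (λ x y → T (R x y)) w z × T (S w) × ¬ T (S z)
  crossing S ε su ¬sv = ⊥-elim (¬sv su)
  crossing S (_◅_ {j = w} r rest) su ¬sv with T? (S w)
  ... | yes sw = crossing S rest sw ¬sv
  ... | no ¬sw = _ , w , r , su , ¬sw

  through-map : ∀ {R S s t u v} → R ⊑ S → Through R s t u v → Through S s t u v
  through-map h (inj₁ (p , q)) = inj₁ (walk-map h p , walk-map h q)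
  through-map h (inj₂ (p , q)) = inj₂ (walk-map h p , walk-map h q)

  through-joins : ∀ {R s t u v} → Through R s t u v → Walk R s t → Walk R u v
  through-joins (inj₁ (p , q)) e = p ◅◅ e ◅◅ q
  through-joins (inj₂ (p , q)) e = p ◅◅ rev e ◅◅ q

  through-closes : ∀ {R s t u v} → Through R s t u v → Walk R u v → Walk R s t
  through-closes (inj₁ (p , q)) w = rev p ◅◅ w ◅◅ rev q
  through-closes (inj₂ (p , q)) w = q ◅◅ rev w ◅◅ p

-- Deciding the existence of a walk by breadth-first search.

module _ {n : ℕ} where

  grow : BRel n → (Fin n → Bool) → Fin n → Bool
  grow R g v = g v ∨ anyFin n (λ w → g w ∧ (R w v ∨ R v w))

  -- reachR R k u : the vertices within distance k of u
  -- (the same recursion as Defs.reach, with the relation in place of edges).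
  reachR : BRel n → ℕ → Fin n → Fin n → Bool
  reachR R zero    u v = ⌊ u ≟ v ⌋
  reachR R (suc k) u v = grow R (reachR R k u) v

  connB : BRel n → Fin n → Fin n → Bool
  connB R = reachR R n

  reach-sound : ∀ R k {u v} → T (reachR R k u v) → Walk R u v
  reach-sound R zero    {u} {v} t with toWitness {a? = u ≟ v} t
  ... | refl = ε
  reach-sound R (suc k) {u} {v} t with ∨-elim {reachR R k u v} t
  ... | inj₁ p = reach-sound R k p
  ... | inj₂ q with anyFin-elim n q
  ...   | w , z with ∨-elim {R w v} (∧-snd {reachR R k u w} z)
  ...     | inj₁ r = reach-sound R k (∧-fst z) ◅◅ (fwd r ◅ ε)
  ...     | inj₂ r = reach-sound R k (∧-fst z) ◅◅ (bwd r ◅ ε)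

  grow-ext : ∀ R g → g ⊆ᵇ grow R g
  grow-ext R g v = ∨-inl

  grow-mono : ∀ R {g h} → g ⊆ᵇ h → grow R g ⊆ᵇ grow R h
  grow-mono R {g} {h} s v t with ∨-elim {g v} t
  ... | inj₁ p = ∨-inl (s v p)
  ... | inj₂ q with anyFin-elim n q
  ...   | w , z = ∨-inr {h v} (anyFin-intro n w (∧-intro (s w (∧-fst z)) (∧-snd {g w} z)))

  reach-mono : ∀ R u d k → reachR R k u ⊆ᵇ reachR R (d ℕ.+ k) u
  reach-mono R u zero    k v t = t
  reach-mono R u (suc d) k v t = grow-ext R _ v (reach-mono R u d k v t)

  reach-stable : ∀ R u j → reachR R (suc j) u ⊆ᵇ reachR R j u →
    ∀ i → reachR R (i ℕ.+ j) u ⊆ᵇ reachR R j u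
  reach-stable R u j st zero    v t = t
  reach-stable R u j st (suc i) v t = st v (grow-mono R (reach-stable R u j st i) v t)

  stabilises : ∀ R u k →
    (Σ[ j ∈ ℕ ] j ≤ k × reachR R (suc j) u ⊆ᵇ reachR R j u) ⊎ (k < countFin n (reachR R k u))
  stabilises R u zero = inj₂ (ℕP.≤-trans (s≤s z≤n)
    (countFin-strict n {p = λ _ → false} (λ _ ()) u (fromWitness {a? = u ≟ u} refl) (λ ())))
  stabilises R u (suc k) with stabilises R u k
  ... | inj₁ (j , j≤k , st) = inj₁ (j , ℕP.m≤n⇒m≤1+n j≤k , st)
  ... | inj₂ big with ⊆ᵇ-dec n (reachR R (suc k) u) (reachR R k u)
  ...   | inj₁ st              = inj₁ (k , ℕP.n≤1+n k , st)
  ...   | inj₂ (v , new , old) = inj₂ (ℕP.<-≤-trans (s≤s big)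
            (countFin-strict n (grow-ext R _) v new old))

  -- Pigeonhole: round n+1 adds nothing.
  saturation : ∀ R u → reachR R (suc n) u ⊆ᵇ reachR R n u
  saturation R u v t with stabilises R u n
  ... | inj₂ big = ⊥-elim (ℕP.<-irrefl refl (ℕP.<-≤-trans big (countFin-≤ n _)))
  ... | inj₁ (j , j≤n , st) =
    subst (λ k → T (reachR R k u v)) (ℕP.m∸n+n≡m j≤n)
      (reach-mono R u (n ∸ j) j v
        (reach-stable R u j st (suc n ∸ j) v
          (subst (λ k → T (reachR R k u v)) (sym (ℕP.m∸n+n≡m (ℕP.m≤n⇒m≤1+n j≤n))) t)))

  -- Search finds every vertex joined to u: the search set after n rounds is
  -- closed under steps, by saturation.
  walk-complete : ∀ {R u v} → Walk R u v → T (connB R u v)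
  walk-complete {R} {u} p = transport (λ x → T (connB R u x)) extend p start
    where
    start : T (connB R u u)
    start = subst (λ k → T (reachR R k u u)) (ℕP.+-identityʳ n)
              (reach-mono R u n 0 u (fromWitness {a? = u ≟ u} refl))
    extend : ∀ {w v} → T (R w v) ⊎ T (R v w) → T (connB R u w) → T (connB R u v)
    extend {w} {v} r cw = saturation R u v (∨-inr {connB R u v}
      (anyFin-intro n w (∧-intro cw (either r))))
      where
      either : T (R w v) ⊎ T (R v w) → T (R w v ∨ R v w)
      either (inj₁ p) = ∨-inl p
      either (inj₂ q) = ∨-inr {R w v} q

  walk-sound : ∀ {R u v} → T (connB R u v) → Walk R u v
  walk-sound {R} = reach-sound R n

  walk? : ∀ R u v → Dec (Walk R u v)
  walk? R u v with T? (connB R u v)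
  ... | yes c = yes (walk-sound c)
  ... | no ¬c = no (¬c ∘ walk-complete)

  connB-ext : ∀ {R S} → R ⊑ S → S ⊑ R → ∀ u v → connB R u v ≡ connB S u v
  connB-ext h g u v = bool-ext (walk-complete ∘ walk-map h ∘ walk-sound)
                               (walk-complete ∘ walk-map g ∘ walk-sound)

  connB-cong : ∀ {R S} → R ≗₂ S → connB R ≗₂ connB S
  connB-cong h = connB-ext (⊑-imp λ u v → subst T (h u v)) (⊑-imp λ u v → subst T (sym (h u v)))

-- Counting the classes of a boolean equivalence relation, exactly as
-- Defs counts the components of (V, A): a class is represented by its
-- least element.

module _ {n : ℕ} where

  compSizeC : BRel n → Fin n → ℕ
  compSizeC c v = countFin n (c v)

  isRepC : BRel n → Fin n → Bool
  isRepC c v = not (anyFin n (λ w → ⌊ w <? v ⌋ ∧ c v w))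

  kC : BRel n → ℕ
  kC c = countFin n (isRepC c)

  kSizeC : BRel n → ℕ → ℕ
  kSizeC c i = countFin n (λ v → isRepC c v ∧ (compSizeC c v ≡ᵇ i))

  isRep-cong : ∀ {c d} → c ≗₂ d → ∀ v → isRepC c v ≡ isRepC d v
  isRep-cong h v = cong not (anyFin-cong n λ w → cong (⌊ w <? v ⌋ ∧_) (h v w))

  kC-cong : ∀ {c d} → c ≗₂ d → kC c ≡ kC d
  kC-cong h = countFin-cong n (isRep-cong h)

  kSizeC-cong : ∀ {c d} → c ≗₂ d → ∀ i → kSizeC c i ≡ kSizeC d i
  kSizeC-cong h i = countFin-cong n λ v →
    cong₂ _∧_ (isRep-cong h v) (cong (_≡ᵇ i) (countFin-cong n (h v)))

  IsEqv : BRel n → Set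
  IsEqv c = IsEquivalence (λ u v → T (c u v))

  connB-isEqv : ∀ R → IsEqv (connB R)
  connB-isEqv R = record
    { refl  = walk-complete {R = R} ε
    ; sym   = λ p → walk-complete {R = R} (rev (walk-sound p))
    ; trans = λ p q → walk-complete {R = R} (walk-sound p ◅◅ walk-sound q)
    }

  notRep : ∀ c {v w} → toℕ w < toℕ v → T (c v w) → ¬ T (isRepC c v)
  notRep c {v} {w} w<v cvw r = not-elim r (anyFin-intro n w (∧-intro (fromWitness {a? = w <? v} w<v) cvw))

  rep : ∀ {c} → IsEqv c → ∀ v → Σ[ r ∈ Fin n ] T (c v r) × T (isRepC c r)
  rep {c} E v = search (suc (toℕ v)) v (ℕP.n<1+n _)
    where
    search : ∀ fuel v → toℕ v < fuel → Σ[ r ∈ Fin n ] T (c v r) × T (isRepC c r)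
    search (suc fuel) v v<fuel with T? (anyFin n (λ w → ⌊ w <? v ⌋ ∧ c v w))
    ... | no ¬smaller = v , IsEquivalence.refl E , not-intro ¬smaller
    ... | yes smaller with anyFin-elim n smaller
    ...   | w , z with search fuel w
                   (ℕP.<-≤-trans (toWitness {a? = w <? v} (∧-fst z)) (ℕP.≤-pred v<fuel))
    ...     | r , cwr , rr = r , IsEquivalence.trans E (∧-snd {⌊ w <? v ⌋} z) cwr , rr

  rep-unique : ∀ {c} → IsEqv c → ∀ {r r′} → T (c r r′) → T (isRepC c r) → T (isRepC c r′) → r ≡ r′
  rep-unique {c} E {r} {r′} crr′ rr rr′ with FinP.<-cmp r r′
  ... | tri< r<r′ _ _ = ⊥-elim (notRep c r<r′ (IsEquivalence.sym E crr′) rr′)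
  ... | tri≈ _ r≡r′ _ = r≡r′
  ... | tri> _ _ r′<r = ⊥-elim (notRep c r′<r crr′ rr)

  isRep-anti : ∀ {c d} → (∀ u v → T (c u v) → T (d u v)) → isRepC d ⊆ᵇ isRepC c
  isRep-anti {c} {d} h v t = not-intro λ a → let (w , z) = anyFin-elim n a in
    not-elim t (anyFin-intro n w (∧-intro (∧-fst z) (h v w (∧-snd {⌊ w <? v ⌋} z))))

  same-count⇒same-classes : ∀ {c d} → IsEqv c → IsEqv d → (∀ u v → T (c u v) → T (d u v)) →
    kC c ≡ kC d → ∀ u v → T (d u v) → T (c u v)
  same-count⇒same-classes {c} {d} Ec Ed h k u v duv with rep Ec u | rep Ec v
  ... | ru , cu , rru | rv , cv , rrv =
    IsEquivalence.trans Ec cu (subst (λ z → T (c z v)) (sym ru≡rv) (IsEquivalence.sym Ec cv))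
    where
    rep-d : isRepC c ⊆ᵇ isRepC d
    rep-d = countFin-≡⇒⊇ n (isRep-anti h) (sym k)
    open IsEquivalence Ed renaming (sym to d-sym; trans to d-trans)
    ru≡rv : ru ≡ rv
    ru≡rv = rep-unique Ed (d-trans (d-sym (h u ru cu)) (d-trans duv (h v rv cv))) (rep-d ru rru) (rep-d rv rrv)

≟-refl : ∀ {n} (x : Fin n) → T ⌊ x ≟ x ⌋
≟-refl x = fromWitness {a? = x ≟ x} refl

-- Inclusion of edge sets (a record, so that the two sets can be inferred).
record _⊆ˢ_ {m} (X Y : Subset m) : Set where
  constructor ⊆ˢ-intro
  field ⊆ˢ-elim : lookup X ⊆ᵇ lookup Y
open _⊆ˢ_ public

module _ {n m : ℕ} (ends : Fin m → Fin n × Fin n) where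

  adjA : Subset m → BRel n
  adjA A u v = anyFin m (λ e → lookup A e ∧ edgeB (src ends e) (tgt ends e) u v)

  adjA-elim : ∀ {A u v} → T (adjA A u v) →
    Σ[ e ∈ Fin m ] T (lookup A e) × T (edgeB (src ends e) (tgt ends e) u v)
  adjA-elim t with anyFin-elim m t
  ... | e , z = e , ∧-fst z , ∧-snd z

  adjA-intro : ∀ {A u v} e → T (lookup A e) → T (edgeB (src ends e) (tgt ends e) u v) → T (adjA A u v)
  adjA-intro e a b = anyFin-intro m e (∧-intro a b)

  rel : BRel n → Subset m → BRel n
  rel R₀ A = R₀ ∪ᵣ adjA A

  CG : BRel n → Subset m → BRel n
  CG R₀ A = connB (rel R₀ A)

  edge-in : ∀ R₀ A e → T (lookup A e) → Walk (rel R₀ A) (src ends e) (tgt ends e)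
  edge-in R₀ A e a = step (∨-inr {R₀ _ _} (adjA-intro {A = A} e a (edgeB-intro (src ends e) (tgt ends e))))

  rel-⊑ : ∀ {S} R₀ A → R₀ ⊑ S → (∀ e → T (lookup A e) → Walk S (src ends e) (tgt ends e)) → rel R₀ A ⊑ S
  rel-⊑ R₀ A h g = ⊑-∪ h adj-⊑
    where
    adj-⊑ : adjA A ⊑ _
    adj-⊑ t with adjA-elim {A = A} t
    ... | e , a , b = edge-⊑ (g e a) b

  rel-mono : ∀ R₀ {A B} → A ⊆ˢ B → rel R₀ A ⊑ rel R₀ B
  rel-mono R₀ {A} {B} h = rel-⊑ R₀ A (⊑-inl {S = adjA B}) (λ e a → edge-in R₀ B e (⊆ˢ-elim h e a))

  walk-mono : ∀ R₀ {A B u v} → A ⊆ˢ B → Walk (rel R₀ A) u v → Walk (rel R₀ B) u v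
  walk-mono R₀ h = walk-map (rel-mono R₀ h)

  R∅ : BRel n
  R∅ _ _ = false

  round-eq : ∀ A (S : Fin n → Bool) v →
    anyFin m (λ e → lookup A e ∧ ((S (src ends e) ∧ ⌊ tgt ends e ≟ v ⌋) ∨ (S (tgt ends e) ∧ ⌊ src ends e ≟ v ⌋)))
      ≡ anyFin n (λ w → S w ∧ (adjA A w v ∨ adjA A v w))
  round-eq A S v = bool-ext by-edge by-vertex
    where
    hits : Fin m → Bool
    hits e = (S (src ends e) ∧ ⌊ tgt ends e ≟ v ⌋) ∨ (S (tgt ends e) ∧ ⌊ src ends e ≟ v ⌋)
    edgeRound vertexRound : Bool
    edgeRound   = anyFin m (λ e → lookup A e ∧ hits e)
    vertexRound = anyFin n (λ w → S w ∧ (adjA A w v ∨ adjA A v w))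
    by-edge : T edgeRound → T vertexRound
    by-edge t with anyFin-elim m t
    ... | e , z with ∨-elim {S (src ends e) ∧ ⌊ tgt ends e ≟ v ⌋} (∧-snd {lookup A e} z)
    ...   | inj₁ q with toWitness {a? = tgt ends e ≟ v} (∧-snd {S (src ends e)} q)
    ...     | refl = anyFin-intro n (src ends e)
                       (∧-intro (∧-fst q) (∨-inl (adjA-intro {A = A} e (∧-fst {lookup A e} z) (edgeB-intro (src ends e) (tgt ends e)))))
    by-edge t | e , z | inj₂ q with toWitness {a? = src ends e ≟ v} (∧-snd {S (tgt ends e)} q)
    ...     | refl = anyFin-intro n (tgt ends e)
                       (∧-intro (∧-fst q) (∨-inr {adjA A _ _} (adjA-intro {A = A} e (∧-fst {lookup A e} z) (edgeB-intro (src ends e) (tgt ends e)))))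
    found : ∀ e → T (lookup A e) → T (hits e) → T edgeRound
    found e a q = anyFin-intro m e (∧-intro a q)
    by-vertex : T vertexRound → T edgeRound
    by-vertex t with anyFin-elim n t
    ... | w , z with ∨-elim {adjA A w v} (∧-snd {S w} z)
    ...   | inj₁ q with adjA-elim {A = A} q
    ...     | e , a , b with edgeB-elim {s = src ends e} {t = tgt ends e} {u = w} {v = v} b
    ...       | inj₁ (refl , refl) = found e a (∨-inl {b = S (tgt ends e) ∧ _} (∧-intro (∧-fst {S (src ends e)} z) (≟-refl _)))
    ...       | inj₂ (refl , refl) = found e a (∨-inr {S (src ends e) ∧ _} (∧-intro (∧-fst {S (tgt ends e)} z) (≟-refl _)))
    by-vertex t | w , z | inj₂ q with adjA-elim {A = A} q
    ...     | e , a , b with edgeB-elim {s = src ends e} {t = tgt ends e} {u = v} {v = w} b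
    ...       | inj₁ (refl , refl) = found e a (∨-inr {S (src ends e) ∧ _} (∧-intro (∧-fst {S (tgt ends e)} z) (≟-refl _)))
    ...       | inj₂ (refl , refl) = found e a (∨-inl {b = S (tgt ends e) ∧ _} (∧-intro (∧-fst {S (src ends e)} z) (≟-refl _)))

  reach-eq : ∀ A k u v → reach ends A k u v ≡ reachR (rel R∅ A) k u v
  reach-eq A zero    u v = refl
  reach-eq A (suc k) u v = cong₂ _∨_ (reach-eq A k u v)
    (trans (anyFin-cong m λ e → cong (lookup A e ∧_)
              (cong₂ _∨_ (cong (_∧ ⌊ tgt ends e ≟ v ⌋) (reach-eq A k u (src ends e)))
                         (cong (_∧ ⌊ src ends e ≟ v ⌋) (reach-eq A k u (tgt ends e)))))
           (round-eq A (reachR (rel R∅ A) k u) v))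

  connected-eq : ∀ A → connected ends A ≗₂ CG R∅ A
  connected-eq A = reach-eq A n

-- The forest and activity notions of Defs, for an arbitrary
-- connectivity function C in place of 'connected ends'.  With
-- C = connected ends they are the notions of Defs by definition.

module Activity {n m : ℕ} (ends : Fin m → Fin n × Fin n) (C : Subset m → BRel n) where

  forestC : Subset m → Bool
  forestC A = allFin m (λ e → not (lookup A e) ∨ not (C (A [ e ]≔ false) (src ends e) (tgt ends e)))

  spanningC : Subset m → Bool
  spanningC A = forestC A ∧ (kC (C A) ≡ᵇ kC (C (allE ends)))

  intActiveC : Subset m → Fin m → Bool
  intActiveC A e = lookup A e ∧ not (anyFin m (λ f →
    not (lookup A f) ∧ ⌊ e <? f ⌋ ∧ spanningC (swap ends A e f)))

  extActiveC : Subset m → Fin m → Bool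
  extActiveC A f = not (lookup A f) ∧ not (anyFin m (λ e →
    lookup A e ∧ ⌊ f <? e ⌋ ∧ spanningC (swap ends A e f)))

  EintC : Subset m → Subset m
  EintC A = tabulate (intActiveC A)

  eActC : Subset m → ℕ
  eActC A = countFin m (extActiveC A)

open Activity

module _ {n m : ℕ} (ends : Fin m → Fin n × Fin n) where

  EintC-ext : ∀ {C₁ C₂} → (∀ A → spanningC ends C₁ A ≡ spanningC ends C₂ A) →
    ∀ A → EintC ends C₁ A ≡ EintC ends C₂ A
  EintC-ext h A = tabulate-cong λ e → cong (λ z → lookup A e ∧ not z)
    (anyFin-cong m λ f → cong (λ z → not (lookup A f) ∧ ⌊ e <? f ⌋ ∧ z) (h _))

  eActC-ext : ∀ {C₁ C₂} → (∀ A → spanningC ends C₁ A ≡ spanningC ends C₂ A) →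
    ∀ A → eActC ends C₁ A ≡ eActC ends C₂ A
  eActC-ext h A = countFin-cong m λ f → cong (λ z → not (lookup A f) ∧ not z)
    (anyFin-cong m λ e → cong (λ z → lookup A e ∧ ⌊ f <? e ⌋ ∧ z) (h _))

  forestC-cong : ∀ {C₁ C₂} → (∀ A → C₁ A ≗₂ C₂ A) → ∀ A → forestC ends C₁ A ≡ forestC ends C₂ A
  forestC-cong h A = allFin-cong m λ e → cong (λ z → not (lookup A e) ∨ not z) (h _ _ _)

  spanningC-cong : ∀ {C₁ C₂} → (∀ A → C₁ A ≗₂ C₂ A) → ∀ A → spanningC ends C₁ A ≡ spanningC ends C₂ A
  spanningC-cong h A = cong₂ _∧_ (forestC-cong h A) (cong₂ _≡ᵇ_ (kC-cong (h A)) (kC-cong (h (allE ends))))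

<-suc : ∀ {m} (e f : Fin m) → ⌊ suc e <? suc f ⌋ ≡ ⌊ e <? f ⌋
<-suc e f = bool-ext (λ t → fromWitness {a? = e <? f} (ℕP.≤-pred (toWitness {a? = suc e <? suc f} t)))
                     (λ t → fromWitness {a? = suc e <? suc f} (s≤s (toWitness {a? = e <? f} t)))

module LeastEdge {n m : ℕ} (ends : Fin (suc m) → Fin n × Fin n) (C : Subset (suc m) → BRel n)
    (c : Bool) (C′ : Subset m → BRel n)
    (split : ∀ X → spanningC ends C (c ∷ X) ≡ spanningC (ends ∘ suc) C′ X) where

  EintC-∷ : ∀ F → EintC ends C (c ∷ F) ≡ intActiveC ends C (c ∷ F) zero ∷ EintC (ends ∘ suc) C′ F
  EintC-∷ F = cong (_ ∷_) (tabulate-cong λ e → cong (λ z → lookup F e ∧ not z)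
    (cong₂ _∨_ (∧-zeroʳ (not c))
      (anyFin-cong m λ f → cong₂ (λ w z → not (lookup F f) ∧ w ∧ z) (<-suc e f) (split _))))

  eActC-∷ : ∀ F → eActC ends C (c ∷ F) ≡ (if extActiveC ends C (c ∷ F) zero then 1 else 0) ℕ.+ eActC (ends ∘ suc) C′ F
  eActC-∷ F = cong (_ ℕ.+_) (countFin-cong m λ f → cong (λ z → not (lookup F f) ∧ not z)
    (cong₂ _∨_ (∧-zeroʳ c)
      (anyFin-cong m λ e → cong₂ (λ w z → lookup F e ∧ w ∧ z) (<-suc f e) (split _))))

module _ {m : ℕ} where

  ⊆-allE : ∀ (X : Subset m) → X ⊆ˢ replicate m true
  ⊆-allE X = ⊆ˢ-intro λ e _ → subst T (sym (lookup-replicate e true)) tt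

  ⊆-del : ∀ (X : Subset m) f → (X [ f ]≔ false) ⊆ˢ X
  ⊆-del X f = ⊆ˢ-intro h
    where
    h : ∀ e → T (lookup (X [ f ]≔ false) e) → T (lookup X e)
    h e t with e ≟ f
    ... | yes refl = ⊥-elim (subst T (lookup∘update f X false) t)
    ... | no e≢f   = subst T (lookup∘update′ e≢f X false) t

  ⊆-add : ∀ (X : Subset m) f → X ⊆ˢ (X [ f ]≔ true)
  ⊆-add X f = ⊆ˢ-intro h
    where
    h : ∀ e → T (lookup X e) → T (lookup (X [ f ]≔ true) e)
    h e t with e ≟ f
    ... | yes refl = subst T (sym (lookup∘update f X true)) tt
    ... | no e≢f   = subst T (sym (lookup∘update′ e≢f X true)) t

  ⊆-del-mono : ∀ {X Y : Subset m} g → X ⊆ˢ Y → (X [ g ]≔ false) ⊆ˢ (Y [ g ]≔ false)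
  ⊆-del-mono {X} {Y} g X⊆Y = ⊆ˢ-intro h
    where
    h : ∀ e → T (lookup (X [ g ]≔ false) e) → T (lookup (Y [ g ]≔ false) e)
    h e t with e ≟ g
    ... | yes refl = ⊥-elim (subst T (lookup∘update g X false) t)
    ... | no e≢g   = subst T (sym (lookup∘update′ e≢g Y false))
                       (⊆ˢ-elim X⊆Y e (subst T (lookup∘update′ e≢g X false) t))

  ⊆-add-del : ∀ (X : Subset m) f → ((X [ f ]≔ true) [ f ]≔ false) ⊆ˢ X
  ⊆-add-del X f = ⊆ˢ-intro h
    where
    h : ∀ e → T (lookup ((X [ f ]≔ true) [ f ]≔ false) e) → T (lookup X e)
    h e t with e ≟ f
    ... | yes refl = ⊥-elim (subst T (lookup∘update e (X [ e ]≔ true) false) t)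
    ... | no e≢f   = subst T (trans (lookup∘update′ e≢f (X [ f ]≔ true) false) (lookup∘update′ e≢f X true)) t

  ⊆-add-del-swap : ∀ (X : Subset m) f g → ((X [ f ]≔ true) [ g ]≔ false) ⊆ˢ ((X [ g ]≔ false) [ f ]≔ true)
  ⊆-add-del-swap X f g = ⊆ˢ-intro h
    where
    h : ∀ e → T (lookup ((X [ f ]≔ true) [ g ]≔ false) e) → T (lookup ((X [ g ]≔ false) [ f ]≔ true) e)
    h e t with e ≟ f | e ≟ g
    ... | yes refl | _        = subst T (sym (lookup∘update e (X [ g ]≔ false) true)) tt
    ... | no _     | yes refl = ⊥-elim (subst T (lookup∘update e (X [ f ]≔ true) false) t)
    ... | no e≢f   | no e≢g   =
      subst T (sym (trans (lookup∘update′ e≢f (X [ g ]≔ false) true) (lookup∘update′ e≢g X false)))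
        (subst T (trans (lookup∘update′ e≢g (X [ f ]≔ true) false) (lookup∘update′ e≢f X true)) t)

module _ {n m : ℕ} (ends : Fin m → Fin n × Fin n) where

  Forest : BRel n → Subset m → Set
  Forest R₀ X = ∀ e → T (lookup X e) → ¬ Walk (rel ends R₀ (X [ e ]≔ false)) (src ends e) (tgt ends e)

  forest-sound : ∀ R₀ X → T (forestC ends (CG ends R₀) X) → Forest R₀ X
  forest-sound R₀ X t e xe w with ∨-elim {not (lookup X e)} (allFin-elim m t e)
  ... | inj₁ q = not-elim q xe
  ... | inj₂ q = not-elim q (walk-complete w)

  forest-complete : ∀ R₀ X → Forest R₀ X → T (forestC ends (CG ends R₀) X)
  forest-complete R₀ X h = allFin-intro m λ e → edge-ok e (T? (lookup X e))
    where
    edge-ok : ∀ e → Dec (T (lookup X e)) →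
      T (not (lookup X e) ∨ not (CG ends R₀ (X [ e ]≔ false) (src ends e) (tgt ends e)))
    edge-ok e (yes xe)  = ∨-inr {not (lookup X e)} (not-intro (h e xe ∘ walk-sound))
    edge-ok e (no ¬xe)  = ∨-inl (not-intro ¬xe)

  SpanningForest : BRel n → Subset m → Set
  SpanningForest R₀ X = Forest R₀ X × kC (CG ends R₀ X) ≡ kC (CG ends R₀ (allE ends))

  spanning-sound : ∀ R₀ X → T (spanningC ends (CG ends R₀) X) → SpanningForest R₀ X
  spanning-sound R₀ X t = forest-sound R₀ X (∧-fst t) , ℕP.≡ᵇ⇒≡ _ _ (∧-snd {forestC ends (CG ends R₀) X} t)

  spanning-complete : ∀ R₀ X → SpanningForest R₀ X → T (spanningC ends (CG ends R₀) X)
  spanning-complete R₀ X (f , k) = ∧-intro (forest-complete R₀ X f) (ℕP.≡⇒≡ᵇ _ _ k)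

  same-components : ∀ R₀ {X Y} → X ⊆ˢ Y → kC (CG ends R₀ X) ≡ kC (CG ends R₀ Y) → rel ends R₀ Y ⊑ rel ends R₀ X
  same-components R₀ {X} {Y} X⊆Y k {u} {v} r = walk-sound
    (same-count⇒same-classes (connB-isEqv (rel ends R₀ X)) (connB-isEqv (rel ends R₀ Y))
      (λ u v c → walk-complete (walk-mono ends R₀ X⊆Y (walk-sound c))) k u v
      (walk-complete {R = rel ends R₀ Y} (step r)))

  kC-from-⊑ : ∀ R₀ {X Y} → X ⊆ˢ Y → rel ends R₀ Y ⊑ rel ends R₀ X → kC (CG ends R₀ X) ≡ kC (CG ends R₀ Y)
  kC-from-⊑ R₀ X⊆Y h = kC-cong (connB-ext (rel-mono ends R₀ X⊆Y) h)

  Joins : Fin m → Fin n → Fin n → Set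
  Joins f u v = (src ends f ≡ u × tgt ends f ≡ v) ⊎ (tgt ends f ≡ u × src ends f ≡ v)

  joins-walk : ∀ R₀ A {f u v} → T (lookup A f) → Joins f u v → Walk (rel ends R₀ A) u v
  joins-walk R₀ A {f} af (inj₁ (refl , refl)) = edge-in ends R₀ A f af
  joins-walk R₀ A {f} af (inj₂ (refl , refl)) = rev (edge-in ends R₀ A f af)

  joins-through : ∀ {R f w z u v} → Joins f w z → Walk R u w → Walk R z v → Through R (src ends f) (tgt ends f) u v
  joins-through (inj₁ (refl , refl)) p q = inj₁ (p , q)
  joins-through (inj₂ (refl , refl)) p q = inj₂ (p , q)

  rel-step : ∀ R₀ A {u v} → SymClosure (λ x y → T (rel ends R₀ A x y)) u v →
    Walk R₀ u v ⊎ Σ[ f ∈ Fin m ] T (lookup A f) × Joins f u v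
  rel-step R₀ A {u} {v} (fwd r) with ∨-elim {R₀ u v} r
  ... | inj₁ r₀ = inj₁ (step r₀)
  ... | inj₂ q with adjA-elim ends {A = A} q
  ...   | f , af , e = inj₂ (f , af , edgeB-elim e)
  rel-step R₀ A {u} {v} (bwd r) with ∨-elim {R₀ v u} r
  ... | inj₁ r₀ = inj₁ (rev (step r₀))
  ... | inj₂ q with adjA-elim ends {A = A} q
  ...   | f , af , e with edgeB-elim e
  ...     | inj₁ (s≡v , t≡u) = inj₂ (f , af , inj₂ (t≡u , s≡v))
  ...     | inj₂ (t≡v , s≡u) = inj₂ (f , af , inj₁ (s≡u , t≡v))

  plus-edge-⊑ : ∀ R₀ {X Y} f → (∀ e → T (lookup X e) → e ≡ f ⊎ T (lookup Y e)) →
    rel ends R₀ X ⊑ (rel ends R₀ Y ∪ᵣ edgeB (src ends f) (tgt ends f))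
  plus-edge-⊑ R₀ {X} {Y} f h = rel-⊑ ends R₀ X
    (⊑-trans (⊑-inl {R = R₀} {S = adjA ends Y}) (⊑-inl {R = rel ends R₀ Y} {S = edgeB (src ends f) (tgt ends f)})) edge
    where
    edge : ∀ e → T (lookup X e) → Walk (rel ends R₀ Y ∪ᵣ edgeB (src ends f) (tgt ends f)) (src ends e) (tgt ends e)
    edge e xe with h e xe
    ... | inj₁ refl = ⊑-inr {R = rel ends R₀ Y} (edgeB-intro (src ends e) (tgt ends e))
    ... | inj₂ ye   = walk-map (⊑-inl {R = rel ends R₀ Y} {S = edgeB (src ends f) (tgt ends f)}) (edge-in ends R₀ Y e ye)

  add-⊑ : ∀ R₀ X f → rel ends R₀ (X [ f ]≔ true) ⊑ (rel ends R₀ X ∪ᵣ edgeB (src ends f) (tgt ends f))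
  add-⊑ R₀ X f = plus-edge-⊑ R₀ {X [ f ]≔ true} {X} f h
    where
    h : ∀ e → T (lookup (X [ f ]≔ true) e) → e ≡ f ⊎ T (lookup X e)
    h e t with e ≟ f
    ... | yes e≡f = inj₁ e≡f
    ... | no e≢f  = inj₂ (subst T (lookup∘update′ e≢f X true) t)

  del-⊑ : ∀ R₀ X f → rel ends R₀ X ⊑ (rel ends R₀ (X [ f ]≔ false) ∪ᵣ edgeB (src ends f) (tgt ends f))
  del-⊑ R₀ X f = plus-edge-⊑ R₀ {X} {X [ f ]≔ false} f h
    where
    h : ∀ e → T (lookup X e) → e ≡ f ⊎ T (lookup (X [ f ]≔ false) e)
    h e t with e ≟ f
    ... | yes e≡f = inj₁ e≡f
    ... | no e≢f  = inj₂ (subst T (sym (lookup∘update′ e≢f X false)) t)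

-- Deletion and contraction of the least edge 0 = {a, b}: the graph
-- without edge 0 is rel ends′ R₀, the contracted graph is rel ends′ R₀″.

module Split {n m : ℕ} (ends : Fin (suc m) → Fin n × Fin n) (R₀ : BRel n) where

  ends′ : Fin m → Fin n × Fin n
  ends′ = ends ∘ suc

  a b : Fin n
  a = src ends zero
  b = tgt ends zero

  R₀″ : BRel n
  R₀″ = R₀ ∪ᵣ edgeB a b

  -- Keeping edge 0 is contracting it.
  keep-≗ : ∀ Z → rel ends R₀ (true ∷ Z) ≗₂ rel ends′ R₀″ Z
  keep-≗ Z u v = sym (∨-assoc (R₀ u v) (edgeB a b u v) (adjA ends′ Z u v))

  deleted-⊑-contracted : ∀ Z → rel ends′ R₀ Z ⊑ rel ends′ R₀″ Z
  deleted-⊑-contracted Z = rel-⊑ ends′ R₀ Z (⊑-trans (⊑-inl {R = R₀} {S = edgeB a b}) (⊑-inl {R = R₀″} {S = adjA ends′ Z}))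
                             (edge-in ends′ R₀″ Z)

  contracted-⊑ : ∀ Z → rel ends′ R₀″ Z ⊑ (rel ends′ R₀ Z ∪ᵣ edgeB a b)
  contracted-⊑ Z = rel-⊑ ends′ R₀″ Z
    (⊑-∪ (⊑-trans (⊑-inl {R = R₀} {S = adjA ends′ Z}) (⊑-inl {R = rel ends′ R₀ Z} {S = edgeB a b}))
         (⊑-inr {R = rel ends′ R₀ Z}))
    (λ e t → walk-map (⊑-inl {R = rel ends′ R₀ Z} {S = edgeB a b}) (edge-in ends′ R₀ Z e t))

  ab-contracted : ∀ Z → Walk (rel ends′ R₀″ Z) a b
  ab-contracted Z = step (∨-inl {b = adjA ends′ Z a b} (∨-inr {R₀ a b} (edgeB-intro a b)))

  keep-exchange : ∀ Z {u v} → Walk (rel ends R₀ (true ∷ Z)) u v →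
    Walk (rel ends′ R₀ Z) u v ⊎ Through (rel ends′ R₀ Z) a b u v
  keep-exchange Z w = exchange (walk-map (⊑-trans (⊑-imp λ u v → subst T (keep-≗ Z u v)) (contracted-⊑ Z)) w)

  keep-⊒ : ∀ Z {u v} → Walk (rel ends′ R₀ Z) u v → Walk (rel ends R₀ (true ∷ Z)) u v
  keep-⊒ Z = walk-map (⊑-trans (deleted-⊑-contracted Z) (⊑-imp λ u v → subst T (sym (keep-≗ Z u v))))

cut : ∀ {n m} (ends : Fin m → Fin n × Fin n) R₀ Y {u v} → ¬ Walk R₀ u v → Walk (rel ends R₀ Y) u v →
  Σ[ e ∈ Fin m ] T (lookup Y e) × Through (rel ends R₀ (Y [ e ]≔ false)) (src ends e) (tgt ends e) u v
cut {m = zero} ends R₀ [] ¬w w = ⊥-elim (¬w (walk-map (⊑-∪ ⊑-refl (λ ())) w))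
cut {m = suc m} ends R₀ (false ∷ Y) ¬w w with cut (ends ∘ suc) R₀ Y ¬w w
... | e , ye , th = suc e , ye , th
cut {m = suc m} ends R₀ (true ∷ Y) ¬w w with Split.keep-exchange ends R₀ Y w
... | inj₂ th = zero , tt , th
... | inj₁ w′ with cut (ends ∘ suc) R₀ Y ¬w w′
...   | e , ye , inj₁ (p , q) = suc e , ye , inj₁ (keep (Y [ e ]≔ false) p , keep (Y [ e ]≔ false) q)
  where keep = Split.keep-⊒ ends R₀
...   | e , ye , inj₂ (p , q) = suc e , ye , inj₂ (keep (Y [ e ]≔ false) p , keep (Y [ e ]≔ false) q)
  where keep = Split.keep-⊒ ends R₀

module Cases {n m : ℕ} (ends : Fin (suc m) → Fin n × Fin n) (R₀ : BRel n) where
  open Split ends R₀ public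

  C : Subset (suc m) → BRel n
  C = CG ends R₀

  C′ C″ : Subset m → BRel n
  C′ = CG ends′ R₀
  C″ = CG ends′ R₀″

  rl rl″ : Subset m → BRel n
  rl  = rel ends′ R₀
  rl″ = rel ends′ R₀″

  E′ : Subset m
  E′ = replicate m true

  keep-CG : ∀ Z → C (true ∷ Z) ≗₂ C″ Z
  keep-CG Z = connB-cong (keep-≗ Z)

  contract-on-cycle : ∀ Z → Walk (rl Z) a b → C″ Z ≗₂ C′ Z
  contract-on-cycle Z w = connB-ext (⊑-trans (contracted-⊑ Z) (⊑-∪ ⊑-refl (edge-⊑ w))) (deleted-⊑-contracted Z)

  uncontract : ∀ {X Z u v} → Z ⊆ˢ X → ¬ Walk (rl X) a b → Walk (rl X) u v → Walk (rl″ Z) u v → Walk (rl Z) u v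
  uncontract {Z = Z} Z⊆X ¬ab uv w with exchange (walk-map (contracted-⊑ Z) w)
  ... | inj₁ q               = q
  ... | inj₂ (inj₁ (p , q))  = ⊥-elim (¬ab (rev (walk-mono ends′ R₀ Z⊆X p) ◅◅ uv ◅◅ rev (walk-mono ends′ R₀ Z⊆X q)))
  ... | inj₂ (inj₂ (p , q))  = ⊥-elim (¬ab (walk-mono ends′ R₀ Z⊆X q ◅◅ rev uv ◅◅ walk-mono ends′ R₀ Z⊆X p))

  spanning-keep-≡ : ∀ X → spanningC ends C (true ∷ X)
    ≡ (not (C′ X a b) ∧ forestC ends′ C″ X) ∧ (kC (C″ X) ≡ᵇ kC (C″ E′))
  spanning-keep-≡ X = cong₂ (λ f k → (not (C′ X a b) ∧ f) ∧ k)
    (forestC-cong ends′ keep-CG X) (cong₂ _≡ᵇ_ (kC-cong (keep-CG X)) (kC-cong (keep-CG E′)))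

  spanning-drop-≡ : ∀ X → spanningC ends C (false ∷ X) ≡ forestC ends′ C′ X ∧ (kC (C′ X) ≡ᵇ kC (C (allE ends)))
  spanning-drop-≡ X = refl

  extActive-drop-≡ : ∀ F → extActiveC ends C (false ∷ F) zero
    ≡ not (anyFin m (λ e → lookup F e ∧ spanningC ends C (true ∷ (F [ e ]≔ false))))
  extActive-drop-≡ F = refl

  intActive-keep-≡ : ∀ F → intActiveC ends C (true ∷ F) zero
    ≡ not (anyFin m (λ f → not (lookup F f) ∧ spanningC ends C (false ∷ (F [ f ]≔ true))))
  intActive-keep-≡ F = refl

  spanning-drop : Walk (rl E′) a b → ∀ X → spanningC ends C (false ∷ X) ≡ spanningC ends′ C′ X
  spanning-drop w X = trans (spanning-drop-≡ X) (cong (λ k → forestC ends′ C′ X ∧ (kC (C′ X) ≡ᵇ k))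
    (trans (kC-cong (keep-CG E′)) (kC-cong (contract-on-cycle E′ w))))

  module Loop (loop : Walk R₀ a b) where

    ab : ∀ X → Walk (rl X) a b
    ab X = walk-map (⊑-inl {R = R₀} {S = adjA ends′ X}) loop

    spanning-keep : ∀ X → spanningC ends C (true ∷ X) ≡ false
    spanning-keep X = trans (spanning-keep-≡ X)
      (cong (λ c → (not c ∧ forestC ends′ C″ X) ∧ (kC (C″ X) ≡ᵇ kC (C″ E′))) (true-≡ (walk-complete (ab X))))

    spanning-drop′ : ∀ X → spanningC ends C (false ∷ X) ≡ spanningC ends′ C′ X
    spanning-drop′ = spanning-drop (ab E′)

    Eint-drop : ∀ F → EintC ends C (false ∷ F) ≡ false ∷ EintC ends′ C′ F
    Eint-drop = LeastEdge.EintC-∷ ends C false C′ spanning-drop′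

    eAct-drop : ∀ F → eActC ends C (false ∷ F) ≡ suc (eActC ends′ C′ F)
    eAct-drop F = trans (LeastEdge.eActC-∷ ends C false C′ spanning-drop′ F)
      (cong (λ z → (if not z then 1 else 0) ℕ.+ eActC ends′ C′ F)
        (anyFin-none m λ e t → subst T (spanning-keep (F [ e ]≔ false)) (∧-snd {lookup F e} t)))

    keep-contracts-nothing : ∀ Z → C (true ∷ Z) ≗₂ C′ Z
    keep-contracts-nothing Z u v = trans (keep-CG Z u v) (contract-on-cycle Z (ab Z) u v)

  module Bridge (bridge : ¬ Walk (rl E′) a b) where

    ¬ab : ∀ X → ¬ Walk (rl X) a b
    ¬ab X = bridge ∘ walk-mono ends′ R₀ (⊆-allE X)

    spanning-drop-false : ∀ X → spanningC ends C (false ∷ X) ≡ false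
    spanning-drop-false X = trans (spanning-drop-≡ X) (trans (cong (forestC ends′ C′ X ∧_) (false-≡ same-count)) (∧-zeroʳ _))
      where
      same-count : ¬ T (kC (C′ X) ≡ᵇ kC (C (allE ends)))
      same-count t = ¬ab X (same-components ends R₀ (⊆-allE (false ∷ X)) (ℕP.≡ᵇ⇒≡ _ _ t)
        (∨-inr {R₀ a b} (adjA-intro ends {A = allE ends} zero tt (edgeB-intro a b))))

    spanning-keep : ∀ X → spanningC ends C (true ∷ X) ≡ spanningC ends′ C″ X
    spanning-keep X = trans (spanning-keep-≡ X)
      (cong (λ c → (not c ∧ forestC ends′ C″ X) ∧ (kC (C″ X) ≡ᵇ kC (C″ E′))) (false-≡ (¬ab X ∘ walk-sound)))

    forest-contract≡delete : ∀ X → forestC ends′ C″ X ≡ forestC ends′ C′ X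
    forest-contract≡delete X = allFin-cong m edge
      where
      edge : ∀ e → (not (lookup X e) ∨ not (C″ (X [ e ]≔ false) (src ends′ e) (tgt ends′ e)))
                 ≡ (not (lookup X e) ∨ not (C′ (X [ e ]≔ false) (src ends′ e) (tgt ends′ e)))
      edge e with lookup X e in xe
      ... | false = refl
      ... | true  = cong not (bool-ext
        (walk-complete ∘ uncontract (⊆-del X e) (¬ab X) (edge-in ends′ R₀ X e (subst T (sym xe) tt)) ∘ walk-sound)
        (walk-complete ∘ walk-map (deleted-⊑-contracted (X [ e ]≔ false)) ∘ walk-sound))

    count-contract≡delete : ∀ X → (kC (C″ X) ≡ᵇ kC (C″ E′)) ≡ (kC (C′ X) ≡ᵇ kC (C′ E′))
    count-contract≡delete X = bool-ext to from
      where
      to : T (kC (C″ X) ≡ᵇ kC (C″ E′)) → T (kC (C′ X) ≡ᵇ kC (C′ E′))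
      to t = ℕP.≡⇒≡ᵇ _ _ (kC-from-⊑ ends′ R₀ (⊆-allE X) λ r →
        uncontract (⊆-allE X) bridge (step r)
          (walk-map (same-components ends′ R₀″ (⊆-allE X) (ℕP.≡ᵇ⇒≡ _ _ t)) (deleted-⊑-contracted E′ r)))
      from : T (kC (C′ X) ≡ᵇ kC (C′ E′)) → T (kC (C″ X) ≡ᵇ kC (C″ E′))
      from t = ℕP.≡⇒≡ᵇ _ _ (kC-from-⊑ ends′ R₀″ (⊆-allE X)
        (rel-⊑ ends′ R₀″ E′ (⊑-inl {R = R₀″} {S = adjA ends′ X}) λ e t′ →
          walk-map (deleted-⊑-contracted X)
            (walk-map (same-components ends′ R₀ (⊆-allE X) (ℕP.≡ᵇ⇒≡ _ _ t)) (edge-in ends′ R₀ E′ e t′))))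

    spanning-contract≡delete : ∀ X → spanningC ends′ C″ X ≡ spanningC ends′ C′ X
    spanning-contract≡delete X = cong₂ _∧_ (forest-contract≡delete X) (count-contract≡delete X)

    Eint-keep : ∀ F → EintC ends C (true ∷ F) ≡ true ∷ EintC ends′ C″ F
    Eint-keep F = trans (LeastEdge.EintC-∷ ends C true C″ spanning-keep F)
      (cong (λ z → not z ∷ EintC ends′ C″ F)
        (anyFin-none m λ f t → subst T (spanning-drop-false (F [ f ]≔ true)) (∧-snd {not (lookup F f)} t)))

    eAct-keep : ∀ F → eActC ends C (true ∷ F) ≡ eActC ends′ C″ F
    eAct-keep = LeastEdge.eActC-∷ ends C true C″ spanning-keep

  module Ordinary (¬loop : ¬ Walk R₀ a b) (cycle : Walk (rl E′) a b) where

    spanning-drop′ : ∀ X → spanningC ends C (false ∷ X) ≡ spanningC ends′ C′ X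
    spanning-drop′ = spanning-drop cycle

    -- In a forest X of the contraction, a ≁ b in G∖0: otherwise an edge of X
    -- would close a cycle through the contracted edge.
    contracted-forest-¬ab : ∀ X → Forest ends′ R₀″ X → ¬ Walk (rl X) a b
    contracted-forest-¬ab X forest w with cut ends′ R₀ X ¬loop w
    ... | e , xe , th = forest e xe
      (through-closes (through-map (deleted-⊑-contracted (X [ e ]≔ false)) th) (ab-contracted (X [ e ]≔ false)))

    spanning-keep : ∀ X → spanningC ends C (true ∷ X) ≡ spanningC ends′ C″ X
    spanning-keep X = trans (spanning-keep-≡ X) (cong (_∧ (kC (C″ X) ≡ᵇ kC (C″ E′))) (bool-ext ∧-snd keep))
      where
      keep : T (forestC ends′ C″ X) → T (not (C′ X a b) ∧ forestC ends′ C″ X)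
      keep f = ∧-intro (not-intro (contracted-forest-¬ab X (forest-sound ends′ R₀″ X f) ∘ walk-sound)) f

    exchange-into-contraction : ∀ F → Forest ends′ R₀ F → rl E′ ⊑ rl F → ∀ e → T (lookup F e) →
      Through (rl (F [ e ]≔ false)) (src ends′ e) (tgt ends′ e) a b → SpanningForest ends′ R₀″ (F [ e ]≔ false)
    exchange-into-contraction F forest span e fe th = forestZ , countZ
      where
      Z = F [ e ]≔ false
      ¬abZ : ¬ Walk (rl Z) a b
      ¬abZ w = forest e fe (through-closes th w)
      forestZ : Forest ends′ R₀″ Z
      forestZ g zg w with exchange (walk-map (contracted-⊑ (Z [ g ]≔ false)) w)
      ... | inj₁ q  = forest g (⊆ˢ-elim (⊆-del F e) g zg) (walk-mono ends′ R₀ (⊆-del-mono g (⊆-del F e)) q)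
      ... | inj₂ th′ = ¬abZ (through-closes (through-map (rel-mono ends′ R₀ (⊆-del Z g)) th′) (edge-in ends′ R₀ Z g zg))
      e-in-contraction : edgeB (src ends′ e) (tgt ends′ e) ⊑ rl″ Z
      e-in-contraction = edge-⊑ (through-closes (through-map (deleted-⊑-contracted Z) th) (ab-contracted Z))
      countZ : kC (C″ Z) ≡ kC (C″ E′)
      countZ = kC-from-⊑ ends′ R₀″ (⊆-allE Z) (rel-⊑ ends′ R₀″ E′ (⊑-inl {R = R₀″} {S = adjA ends′ Z}) λ g tg →
        walk-map (⊑-∪ (deleted-⊑-contracted Z) e-in-contraction)
          (walk-map (del-⊑ ends′ R₀ F e) (walk-map span (edge-in ends′ R₀ E′ g tg))))

    exchange-into-deletion : ∀ F → Forest ends′ R₀″ F → rl″ E′ ⊑ rl″ F → ∀ f → ¬ T (lookup F f) →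
      Through (rl F) (src ends′ f) (tgt ends′ f) a b → SpanningForest ends′ R₀ (F [ f ]≔ true)
    exchange-into-deletion F forest span f ¬ff th = forestG , countG
      where
      G = F [ f ]≔ true
      ¬st : ¬ Walk (rl F) (src ends′ f) (tgt ends′ f)
      ¬st = contracted-forest-¬ab F forest ∘ through-joins th
      forestG : Forest ends′ R₀ G
      forestG g gg w with g ≟ f
      ... | yes refl = ¬st (walk-mono ends′ R₀ (⊆-add-del F g) w)
      ... | no g≢f with exchange (walk-map (add-⊑ ends′ R₀ (F [ g ]≔ false) f) (walk-mono ends′ R₀ (⊆-add-del-swap F f g) w))
      ...   | inj₁ q   = forest g (subst T (lookup∘update′ g≢f F true) gg) (walk-map (deleted-⊑-contracted (F [ g ]≔ false)) q)
      ...   | inj₂ th′ = ¬st (through-closes (through-map (rel-mono ends′ R₀ (⊆-del F g)) th′)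
                                (edge-in ends′ R₀ F g (subst T (lookup∘update′ g≢f F true) gg)))
      ab-in-G : edgeB a b ⊑ rl G
      ab-in-G = edge-⊑ (through-joins (through-map (rel-mono ends′ R₀ (⊆-add F f)) th)
                         (edge-in ends′ R₀ G f (subst T (sym (lookup∘update f F true)) tt)))
      countG : kC (C′ G) ≡ kC (C′ E′)
      countG = kC-from-⊑ ends′ R₀ (⊆-allE G) (rel-⊑ ends′ R₀ E′ (⊑-inl {R = R₀} {S = adjA ends′ G}) λ g tg →
        walk-map (⊑-∪ (rel-mono ends′ R₀ (⊆-add F f)) ab-in-G)
          (walk-map (contracted-⊑ F) (walk-map span (walk-map (deleted-⊑-contracted E′) (edge-in ends′ R₀ E′ g tg)))))

    -- In a spanning forest F of G/0, some edge f ∉ F joins a and b through F: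
    -- follow the cycle of edge 0 until it leaves the component of a in F.
    replacement : ∀ F → Forest ends′ R₀″ F → rl″ E′ ⊑ rl″ F →
      Σ[ f ∈ Fin m ] ¬ T (lookup F f) × Through (rl F) (src ends′ f) (tgt ends′ f) a b
    replacement F forest span
      with crossing (C′ F a) cycle (walk-complete {R = rl F} ε) (contracted-forest-¬ab F forest ∘ walk-sound)
    ... | w , z , r , aw , ¬az = edge-found (rel-step ends′ R₀ E′ r) sides
      where
      ¬wz : ¬ Walk (rl F) w z
      ¬wz q = ¬az (walk-complete (walk-sound aw ◅◅ q))
      sides : Walk (rl F) a w × Walk (rl F) z b
      sides with exchange (walk-map (contracted-⊑ F) (walk-map span (walk-map (deleted-⊑-contracted E′) (r ◅ ε))))
      ... | inj₁ q               = ⊥-elim (¬wz q)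
      ... | inj₂ (inj₁ (p , q))  = rev p , rev q
      ... | inj₂ (inj₂ (_ , q))  = ⊥-elim (¬az (walk-complete q))
      edge-found : Walk R₀ w z ⊎ Σ[ f ∈ Fin m ] T (lookup E′ f) × Joins ends′ f w z →
        Walk (rl F) a w × Walk (rl F) z b →
        Σ[ f ∈ Fin m ] ¬ T (lookup F f) × Through (rl F) (src ends′ f) (tgt ends′ f) a b
      edge-found (inj₁ r₀) _ = ⊥-elim (¬wz (walk-map (⊑-inl {R = R₀} {S = adjA ends′ F}) r₀))
      edge-found (inj₂ (f , _ , j)) (p , q) with T? (lookup F f)
      ... | yes ff = ⊥-elim (¬wz (joins-walk ends′ R₀ F ff j))
      ... | no ¬ff = f , ¬ff , joins-through ends′ j p q

    drop-inactive : ∀ F → T (spanningC ends′ C′ F) → extActiveC ends C (false ∷ F) zero ≡ false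
    drop-inactive F t with spanning-sound ends′ R₀ F t
    ... | forest , count with cut ends′ R₀ F ¬loop (walk-map (same-components ends′ R₀ (⊆-allE F) count) cycle)
    ...   | e , fe , th = trans (extActive-drop-≡ F) (cong not (anyFin-some m e (∧-intro fe (subst T (sym (spanning-keep (F [ e ]≔ false)))
            (spanning-complete ends′ R₀″ (F [ e ]≔ false)
              (exchange-into-contraction F forest (same-components ends′ R₀ (⊆-allE F) count) e fe th))))))

    keep-inactive : ∀ F → T (spanningC ends′ C″ F) → intActiveC ends C (true ∷ F) zero ≡ false
    keep-inactive F t with spanning-sound ends′ R₀″ F t
    ... | forest , count with replacement F forest (same-components ends′ R₀″ (⊆-allE F) count)
    ...   | f , ¬ff , th = trans (intActive-keep-≡ F) (cong not (anyFin-some m f (∧-intro (not-intro ¬ff) (subst T (sym (spanning-drop′ (F [ f ]≔ true)))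
            (spanning-complete ends′ R₀ (F [ f ]≔ true)
              (exchange-into-deletion F forest (same-components ends′ R₀″ (⊆-allE F) count) f ¬ff th))))))

    Eint-drop : ∀ F → EintC ends C (false ∷ F) ≡ false ∷ EintC ends′ C′ F
    Eint-drop = LeastEdge.EintC-∷ ends C false C′ spanning-drop′

    eAct-drop : ∀ F → T (spanningC ends′ C′ F) → eActC ends C (false ∷ F) ≡ eActC ends′ C′ F
    eAct-drop F t = trans (LeastEdge.eActC-∷ ends C false C′ spanning-drop′ F)
      (cong (λ z → (if z then 1 else 0) ℕ.+ eActC ends′ C′ F) (drop-inactive F t))

    Eint-keep : ∀ F → T (spanningC ends′ C″ F) → EintC ends C (true ∷ F) ≡ false ∷ EintC ends′ C″ F
    Eint-keep F t = trans (LeastEdge.EintC-∷ ends C true C″ spanning-keep F) (cong (_∷ EintC ends′ C″ F) (keep-inactive F t))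

    eAct-keep : ∀ F → eActC ends C (true ∷ F) ≡ eActC ends′ C″ F
    eAct-keep = LeastEdge.eActC-∷ ends C true C″ spanning-keep

module Sums {c ℓ : Level} (R : CommutativeSemiring c ℓ) where
  open CommutativeSemiring R renaming (refl to ≈-refl; sym to ≈-sym; trans to ≈-trans) hiding (zero)
  open import Algebra.Properties.CommutativeSemigroup +-commutativeSemigroup using (interchange)
  open Poly R using (sumSubsets)

  ≡⇒≈ : ∀ {u v} → u ≡ v → u ≈ v
  ≡⇒≈ refl = ≈-refl

  sum-cong : ∀ m {f g : Subset m → Carrier} → (∀ A → f A ≈ g A) → sumSubsets m f ≈ sumSubsets m g
  sum-cong zero    h = h []
  sum-cong (suc m) h = +-cong (sum-cong m (h ∘ (false ∷_))) (sum-cong m (h ∘ (true ∷_)))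

  sum-+ : ∀ m (f g : Subset m → Carrier) → sumSubsets m (λ A → f A + g A) ≈ sumSubsets m f + sumSubsets m g
  sum-+ zero    f g = ≈-refl
  sum-+ (suc m) f g = ≈-trans (+-cong (sum-+ m _ _) (sum-+ m _ _)) (interchange _ _ _ _)

  sum-* : ∀ m k (f : Subset m → Carrier) → sumSubsets m (λ A → k * f A) ≈ k * sumSubsets m f
  sum-* zero    k f = ≈-refl
  sum-* (suc m) k f = ≈-trans (+-cong (sum-* m k _) (sum-* m k _)) (≈-sym (distribˡ k _ _))

  sum-0 : ∀ m → sumSubsets m (λ _ → 0#) ≈ 0#
  sum-0 zero    = ≈-refl
  sum-0 (suc m) = ≈-trans (+-cong (sum-0 m) (sum-0 m)) (+-identityˡ 0#)

  if-* : ∀ s k X → (if s then k * X else 0#) ≈ k * (if s then X else 0#)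
  if-* true  k X = ≈-refl
  if-* false k X = ≈-sym (zeroʳ k)

  if-+ : ∀ s X Y → (if s then X + Y else 0#) ≈ (if s then X else 0#) + (if s then Y else 0#)
  if-+ true  X Y = ≈-refl
  if-+ false X Y = ≈-sym (+-identityˡ 0#)

  if-cong : ∀ {s s′ X Y} → s ≡ s′ → (T s′ → X ≈ Y) → (if s then X else 0#) ≈ (if s′ then Y else 0#)
  if-cong {true}  refl h = h tt
  if-cong {false} refl h = ≈-refl

  if-false : ∀ {s X} → s ≡ false → (if s then X else 0#) ≈ 0#
  if-false refl = ≈-refl

module Expansion {c ℓ : Level} (R : CommutativeSemiring c ℓ) {n : ℕ} (x : Fin n → CommutativeSemiring.Carrier R)
    (y : CommutativeSemiring.Carrier R) where
  open CommutativeSemiring R renaming (refl to ≈-refl; sym to ≈-sym; trans to ≈-trans) hiding (zero)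
  open import Algebra.Definitions.RawSemiring rawSemiring using (_^_; product)
  open import Algebra.Properties.Monoid.Sum *-monoid using () renaming (sum-cong-≗ to product-cong)
  open Poly R using (sumSubsets)
  open Sums R

  *-swap : ∀ u v w → u * (v * w) ≈ v * (u * w)
  *-swap u v w = ≈-trans (≈-sym (*-assoc u v w)) (≈-trans (*-congʳ (*-comm u v)) (*-assoc v u w))

  xmonoC : BRel n → Carrier
  xmonoC c = product (λ j → x j ^ kSizeC c (suc (toℕ j)))

  xmonoC-cong : ∀ {c d} → c ≗₂ d → xmonoC c ≡ xmonoC d
  xmonoC-cong h = product-cong (λ j → cong (x j ^_) (kSizeC-cong h (suc (toℕ j))))

  W : ∀ {m} → (Subset m → BRel n) → Subset m → Carrier
  W C Z = xmonoC (C Z) * y ^ ∣ Z ∣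

  Inner : ∀ {m} → Subset m → Subset m → ℕ → (Subset m → Carrier) → Carrier
  Inner {m} E F k g = sumSubsets m (λ Aᵢ → if subsetᵇ Aᵢ E then g (F ─ Aᵢ) * (1# + y) ^ k else 0#)

  Φ : ∀ {m} → (Fin m → Fin n × Fin n) → (Subset m → BRel n) → Subset m → Carrier
  Φ ends C F = if spanningC ends C F then Inner (EintC ends C F) F (eActC ends C F) (W C) else 0#

  FE : ∀ {m} → (Fin m → Fin n × Fin n) → (Subset m → BRel n) → Carrier
  FE {m} ends C = sumSubsets m (Φ ends C)

  Inner-cong : ∀ {m} E F k {g h : Subset m → Carrier} → (∀ Z → g Z ≈ h Z) → Inner E F k g ≈ Inner E F k h
  Inner-cong {m} E F k h = sum-cong m λ Aᵢ → if-cong {s = subsetᵇ Aᵢ E} refl (λ _ → *-congʳ (h _))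

  Inner-* : ∀ {m} E F k q (g : Subset m → Carrier) → Inner E F k (λ Z → q * g Z) ≈ q * Inner E F k g
  Inner-* {m} E F k q g = ≈-trans
    (sum-cong m λ Aᵢ → ≈-trans (if-cong {s = subsetᵇ Aᵢ E} refl (λ _ → *-assoc q _ _)) (if-* (subsetᵇ Aᵢ E) q _))
    (sum-* m q _)

  Inner-suc : ∀ {m} E F k (g : Subset m → Carrier) → Inner E F (suc k) g ≈ (1# + y) * Inner E F k g
  Inner-suc {m} E F k g = ≈-trans
    (sum-cong m λ Aᵢ → ≈-trans (if-cong {s = subsetᵇ Aᵢ E} refl (λ _ → *-swap _ _ _)) (if-* (subsetᵇ Aᵢ E) (1# + y) _))
    (sum-* m (1# + y) _)

  -- Splitting Aᵢ at edge 0: removing edge 0 from F is allowed iff it is internally active.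
  Inner-∷ : ∀ {m} c (F : Subset m) β E k g → Inner (β ∷ E) (c ∷ F) k g ≈
    Inner E F k (λ Z → g (c ∷ Z)) + (if β then Inner E F k (λ Z → g (false ∷ Z)) else 0#)
  Inner-∷ c F true  E k g = ≈-refl
  Inner-∷ {m} c F false E k g = +-congˡ (sum-0 m)

  Φ-∷ : ∀ {m} (ends : Fin (suc m) → Fin n × Fin n) C c F {s} β E k →
    spanningC ends C (c ∷ F) ≡ s → (T s → EintC ends C (c ∷ F) ≡ β ∷ E) → (T s → eActC ends C (c ∷ F) ≡ k) →
    Φ ends C (c ∷ F) ≈ (if s then Inner E F k (λ Z → W C (c ∷ Z)) + (if β then Inner E F k (λ Z → W C (false ∷ Z)) else 0#)
                        else 0#)
  Φ-∷ ends C c F β E k sp ei ea = if-cong sp λ t →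
    ≈-trans (≡⇒≈ (cong₂ (λ E′ k′ → Inner E′ (c ∷ F) k′ (W C)) (ei t) (ea t))) (Inner-∷ c F β E k (W C))

  W-keep : ∀ {m} {C : Subset (suc m) → BRel n} {C₂ : Subset m → BRel n} →
    (∀ Z → C (true ∷ Z) ≗₂ C₂ Z) → ∀ Z → W C (true ∷ Z) ≈ y * W C₂ Z
  W-keep h Z = ≈-trans (*-congʳ {x = y ^ suc ∣ Z ∣} (≡⇒≈ (xmonoC-cong (h Z)))) (*-swap _ y _)

  U-cong : ∀ {m} {C₁ C₂ : Subset m → BRel n} → (∀ A → C₁ A ≗₂ C₂ A) → sumSubsets m (W C₁) ≈ sumSubsets m (W C₂)
  U-cong {m} h = sum-cong m λ A → *-congʳ {x = y ^ ∣ A ∣} (≡⇒≈ (xmonoC-cong (h A)))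

  FE-cong : ∀ {m} (ends : Fin m → Fin n × Fin n) {C₁ C₂} → (∀ A → C₁ A ≗₂ C₂ A) → FE ends C₁ ≈ FE ends C₂
  FE-cong {m} ends {C₁} {C₂} h = sum-cong m λ F → if-cong (spanningC-cong ends h F) λ _ →
    ≈-trans (≡⇒≈ (cong₂ (λ E k → Inner E F k (W C₁)) (EintC-ext ends (spanningC-cong ends h) F)
                                                     (eActC-ext ends (spanningC-cong ends h) F)))
            (Inner-cong (EintC ends C₂ F) F (eActC ends C₂ F) λ Z → *-congʳ {x = y ^ ∣ Z ∣} (≡⇒≈ (xmonoC-cong (h Z))))

  module Step {m : ℕ} (ends : Fin (suc m) → Fin n × Fin n) (R₀ : BRel n) where
    open Cases ends R₀
    open import Relation.Binary.Reasoning.Setoid setoid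

    U U′ U″ : Carrier
    U  = sumSubsets (suc m) (W C)
    U′ = sumSubsets m (W C′)
    U″ = sumSubsets m (W C″)

    U-keep : sumSubsets m (λ Z → W C (true ∷ Z)) ≈ y * U″
    U-keep = ≈-trans (sum-cong m (W-keep {C = C} keep-CG)) (sum-* m y _)

    loop-step : Walk R₀ a b → U′ ≈ FE ends′ C′ → U ≈ FE ends C
    loop-step loop ih = begin
      U′ + sumSubsets m (λ Z → W C (true ∷ Z))  ≈⟨ +-congˡ (≈-trans (sum-cong m (W-keep {C = C} keep-contracts-nothing)) (sum-* m y _)) ⟩
      U′ + y * U′                               ≈⟨ +-congʳ (≈-sym (*-identityˡ U′)) ⟩
      1# * U′ + y * U′                          ≈⟨ ≈-sym (distribʳ U′ 1# y) ⟩
      (1# + y) * U′                             ≈⟨ *-congˡ ih ⟩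
      (1# + y) * FE ends′ C′                    ≈⟨ ≈-sym (+-identityʳ _) ⟩
      (1# + y) * FE ends′ C′ + 0#               ≈⟨ ≈-sym (+-cong (≈-trans (sum-cong m drop) (sum-* m (1# + y) _))
                                                                  (≈-trans (sum-cong m keep) (sum-0 m))) ⟩
      FE ends C                                 ∎
      where
      open Loop loop
      drop : ∀ F → Φ ends C (false ∷ F) ≈ (1# + y) * Φ ends′ C′ F
      drop F = ≈-trans (Φ-∷ ends C false F false (EintC ends′ C′ F) (suc (eActC ends′ C′ F))
                              (spanning-drop′ F) (λ _ → Eint-drop F) (λ _ → eAct-drop F))
                 (≈-trans (if-cong {s = spanningC ends′ C′ F} refl λ _ → ≈-trans (+-identityʳ _) (Inner-suc (EintC ends′ C′ F) F (eActC ends′ C′ F) (W C′)))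
                          (if-* (spanningC ends′ C′ F) (1# + y) _))
      keep : ∀ F → Φ ends C (true ∷ F) ≈ 0#
      keep F = if-false (spanning-keep F)

    bridge-step : ¬ Walk (rl E′) a b → U′ ≈ FE ends′ C′ → U″ ≈ FE ends′ C″ → U ≈ FE ends C
    bridge-step bridge ih′ ih″ = begin
      U′ + sumSubsets m (λ Z → W C (true ∷ Z))  ≈⟨ +-cong ih′ (≈-trans U-keep (*-congˡ ih″)) ⟩
      FE ends′ C′ + y * FE ends′ C″              ≈⟨ +-comm _ _ ⟩
      y * FE ends′ C″ + FE ends′ C′              ≈⟨ ≈-sym (+-identityˡ _) ⟩
      0# + (y * FE ends′ C″ + FE ends′ C′)       ≈⟨ ≈-sym (+-cong (≈-trans (sum-cong m drop) (sum-0 m))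
                                                   (≈-trans (sum-cong m keep) (≈-trans (sum-+ m _ _) (+-congʳ (sum-* m y _))))) ⟩
      FE ends C                                 ∎
      where
      open Bridge bridge
      drop : ∀ F → Φ ends C (false ∷ F) ≈ 0#
      drop F = if-false (spanning-drop-false F)
      as-deletion : ∀ F → Inner (EintC ends′ C″ F) F (eActC ends′ C″ F) (W C′) ≡ Inner (EintC ends′ C′ F) F (eActC ends′ C′ F) (W C′)
      as-deletion F = cong₂ (λ E k → Inner E F k (W C′)) (EintC-ext ends′ spanning-contract≡delete F)
                                                        (eActC-ext ends′ spanning-contract≡delete F)
      keep : ∀ F → Φ ends C (true ∷ F) ≈ y * Φ ends′ C″ F + Φ ends′ C′ F
      keep F = ≈-trans (Φ-∷ ends C true F true (EintC ends′ C″ F) (eActC ends′ C″ F)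
                              (spanning-keep F) (λ _ → Eint-keep F) (λ _ → eAct-keep F))
        (≈-trans (if-+ (spanningC ends′ C″ F) _ _)
          (+-cong (≈-trans (if-cong {s = spanningC ends′ C″ F} refl λ _ → ≈-trans (Inner-cong (EintC ends′ C″ F) F (eActC ends′ C″ F) (W-keep {C = C} keep-CG))
                     (Inner-* (EintC ends′ C″ F) F (eActC ends′ C″ F) y (W C″)))
                           (if-* (spanningC ends′ C″ F) y _))
                  (if-cong (spanning-contract≡delete F) λ _ → ≡⇒≈ (as-deletion F))))

    ordinary-step : ¬ Walk R₀ a b → Walk (rl E′) a b → U′ ≈ FE ends′ C′ → U″ ≈ FE ends′ C″ → U ≈ FE ends C
    ordinary-step ¬loop cycle ih′ ih″ = begin
      U′ + sumSubsets m (λ Z → W C (true ∷ Z))  ≈⟨ +-cong ih′ (≈-trans U-keep (*-congˡ ih″)) ⟩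
      FE ends′ C′ + y * FE ends′ C″              ≈⟨ ≈-sym (+-cong (sum-cong m drop) (≈-trans (sum-cong m keep) (sum-* m y _))) ⟩
      FE ends C                                 ∎
      where
      open Ordinary ¬loop cycle
      drop : ∀ F → Φ ends C (false ∷ F) ≈ Φ ends′ C′ F
      drop F = ≈-trans (Φ-∷ ends C false F false (EintC ends′ C′ F) (eActC ends′ C′ F)
                              (spanning-drop′ F) (λ _ → Eint-drop F) (eAct-drop F))
                 (if-cong {s = spanningC ends′ C′ F} refl λ _ → +-identityʳ _)
      keep : ∀ F → Φ ends C (true ∷ F) ≈ y * Φ ends′ C″ F
      keep F = ≈-trans (Φ-∷ ends C true F false (EintC ends′ C″ F) (eActC ends′ C″ F)
                              (spanning-keep F) (Eint-keep F) (λ _ → eAct-keep F))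
        (≈-trans (if-cong {s = spanningC ends′ C″ F} refl λ _ → ≈-trans (+-identityʳ _)
                   (≈-trans (Inner-cong (EintC ends′ C″ F) F (eActC ends′ C″ F) (W-keep {C = C} keep-CG))
                     (Inner-* (EintC ends′ C″ F) F (eActC ends′ C″ F) y (W C″))))
                 (if-* (spanningC ends′ C″ F) y _))

  expansion : ∀ m (ends : Fin m → Fin n × Fin n) R₀ → sumSubsets m (W (CG ends R₀)) ≈ FE ends (CG ends R₀)
  expansion zero ends R₀ =
    ≈-sym (≈-trans (if-cong (true-≡ (ℕP.≡⇒≡ᵇ (kC (CG ends R₀ [])) _ refl)) λ _ → ≈-refl) (*-identityʳ _))
  expansion (suc m) ends R₀ with walk? R₀ (Cases.a ends R₀) (Cases.b ends R₀)
                              | walk? (Cases.rl ends R₀ (Cases.E′ ends R₀)) (Cases.a ends R₀) (Cases.b ends R₀)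
  ... | yes loop  | _         = Step.loop-step ends R₀ loop (expansion m (ends ∘ suc) R₀)
  ... | no ¬loop  | yes cycle = Step.ordinary-step ends R₀ ¬loop cycle
                                  (expansion m (ends ∘ suc) R₀) (expansion m (ends ∘ suc) (Cases.R₀″ ends R₀))
  ... | no _      | no bridge = Step.bridge-step ends R₀ bridge
                                  (expansion m (ends ∘ suc) R₀) (expansion m (ends ∘ suc) (Cases.R₀″ ends R₀))

theorem3p8 : {c ℓ : Level} (R : CommutativeSemiring c ℓ) (n m : ℕ)
    (ends : Fin m → Fin n × Fin n)
    (x : Fin n → CommutativeSemiring.Carrier R) (y : CommutativeSemiring.Carrier R) →
    CommutativeSemiring._≈_ R (Poly.U′ R ends x y) (Poly.forestExpansion R ends x y)
theorem3p8 R n m ends x y = begin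
    Poly.U′ R ends x y                 ≈⟨ U-cong (connected-eq ends) ⟩
    sumSubsets m (W (CG ends (R∅ ends)))  ≈⟨ expansion m ends (R∅ ends) ⟩
    FE ends (CG ends (R∅ ends))          ≈⟨ FE-cong ends (λ A u v → sym (connected-eq ends A u v)) ⟩
    Poly.forestExpansion R ends x y    ∎
  where
  open CommutativeSemiring R using (setoid)
  open import Relation.Binary.Reasoning.Setoid setoid
  open Poly R using (sumSubsets)
  open Expansion R x y
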